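{- If $G$ is a propeller or a windmill, then $G$ is well-edge-dominated.
   Context: A set $F\subseteq E(G)$ is an edge dominating set if every edge of $G$ is in $F$ or shares an endpoint with an edge of $F$; $G$ is well-edge-dominated if all minimal (under inclusion) edge dominating sets have the same cardinality. A propeller is, for some $k\ge1$, the graph obtained from $k$ disjoint triangles by identifying one vertex of each triangle into a single vertex (so $K_3$ is a propeller). The house graph $\mathcal{H}$ has vertices $p_1,p_2,p_3,p_4,q$ and edges $p_1p_2,p_2p_3,p_3p_4,p_4p_1,p_3q,p_4q$. A windmill is, for some $k\ge0$, the graph obtained from $\mathcal{H}$ and $k$ disjoint triangles by identifying $q$ and one vertex of each triangle into a single vertex ($\mathcal{H}$ itself is a windmill). -}

module Defs where

open import Data.Nat using (ℕ; zero; suc; _+_; _*_; _/_; _≡ᵇ_; _<ᵇ_)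
open import Data.Bool using (Bool; true; false; _∧_; _∨_; not; if_then_else_)
open import Data.Fin using (Fin; toℕ)
open import Data.List using (List; map; concatMap; allFin)
open import Data.Nat.ListAction using (sum)
open import Data.Product using (Σ; ∃; ∃-syntax; _×_)
open import Data.Sum using (_⊎_)
open import Relation.Binary.PropositionalEquality using (_≡_)
open import Function.Bundles using (_↔_; Inverse)

record Graph : Set where
  field
    n      : ℕ
    adj    : Fin n → Fin n → Bool
    sym    : ∀ u v → adj u v ≡ adj v u
    irrefl : ∀ v → adj v v ≡ false
open Graph public

record EdgeSet (G : Graph) : Set where
  field
    mem    : Fin (n G) → Fin (n G) → Bool
    msym   : ∀ u v → mem u v ≡ mem v u
    sub    : ∀ u v → mem u v ≡ true → adj G u v ≡ true
open EdgeSet public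

_⊆ₑ_ : {G : Graph} → EdgeSet G → EdgeSet G → Set
F ⊆ₑ F' = ∀ u v → mem F u v ≡ true → mem F' u v ≡ true

size : {G : Graph} → EdgeSet G → ℕ
size {G} F =
  sum (concatMap (λ u → map (λ v → if mem F u v ∧ (toℕ u <ᵇ toℕ v) then 1 else 0)
                            (allFin (n G)))
                 (allFin (n G)))

-- F is an edge dominating set: every edge uv of G is in F or shares an
-- endpoint with an edge of F; i.e. some edge xy of F has x ∈ {u, v}
-- (uv ∈ F is covered by x = u, y = v).
IsEDS : {G : Graph} → EdgeSet G → Set
IsEDS {G} F = ∀ u v → adj G u v ≡ true →
  ∃[ x ] ∃[ y ] (mem F x y ≡ true × (x ≡ u ⊎ x ≡ v))

IsMinimalEDS : {G : Graph} → EdgeSet G → Set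
IsMinimalEDS {G} F = IsEDS F × (∀ (F' : EdgeSet G) → F' ⊆ₑ F → IsEDS F' → F ⊆ₑ F')

WellEdgeDominated : Graph → Set
WellEdgeDominated G = ∀ (F F' : EdgeSet G) → IsMinimalEDS F → IsMinimalEDS F' → size F ≡ size F'

_≅_ : (G : Graph) → Σ ℕ (λ m → Fin m → Fin m → Bool) → Set
G ≅ (m Data.Product., A) =
  Σ (Fin (n G) ↔ Fin m) λ f → ∀ u v → adj G u v ≡ A (Inverse.to f u) (Inverse.to f v)

-- Propeller with k triangles: vertex 0 is the common centre; triangle i
-- (i < k) has the further vertices 1+2i and 2+2i.  Vertex set Fin (1 + 2k).

propellerAdjℕ : ℕ → ℕ → Bool
propellerAdjℕ zero    zero    = false
propellerAdjℕ zero    (suc b) = true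
propellerAdjℕ (suc a) zero    = true
propellerAdjℕ (suc a) (suc b) = ((a / 2) ≡ᵇ (b / 2)) ∧ not (a ≡ᵇ b)

propeller : ℕ → Σ ℕ (λ m → Fin m → Fin m → Bool)
propeller k = (1 + 2 * k) Data.Product., (λ u v → propellerAdjℕ (toℕ u) (toℕ v))

-- Windmill with k triangles: vertices 0 = q, 1 = p₁, 2 = p₂, 3 = p₃, 4 = p₄
-- (the house H: p₁p₂, p₂p₃, p₃p₄, p₄p₁, p₃q, p₄q), and triangle i (i < k)
-- has the further vertices 5+2i and 6+2i, both adjacent to q.

houseEdge : ℕ → ℕ → Bool
houseEdge 1 2 = true
houseEdge 2 3 = true
houseEdge 3 4 = true
houseEdge 4 1 = true
houseEdge 3 0 = true
houseEdge 4 0 = true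
houseEdge _ _ = false

windmillEdge : ℕ → ℕ → Bool
windmillEdge a b =
  houseEdge a b
  ∨ ((a ≡ᵇ 0) ∧ (4 <ᵇ b))
  ∨ ((4 <ᵇ a) ∧ (4 <ᵇ b) ∧ (a <ᵇ b) ∧ (((a + 1) / 2) ≡ᵇ ((b + 1) / 2)))

windmillAdjℕ : ℕ → ℕ → Bool
windmillAdjℕ a b = windmillEdge a b ∨ windmillEdge b a

windmill : ℕ → Σ ℕ (λ m → Fin m → Fin m → Bool)
windmill k = (5 + 2 * k) Data.Product., (λ u v → windmillAdjℕ (toℕ u) (toℕ v))

IsPropeller : Graph → Set
IsPropeller G = ∃[ k ] (1 Data.Nat.≤ k × G ≅ propeller k)

IsWindmill : Graph → Set
IsWindmill G = ∃[ k ] (G ≅ windmill k)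

{-# OPTIONS --safe #-}
module Submission where

-- In a minimal edge dominating set F every pendant triangle z a b (a and b adjacent only to each
-- other and to z) contains exactly one edge of F: at least one because ab must be dominated, and
-- at most one because every edge touching zb or ab also touches za and every edge touching ab
-- touches zb, so a second edge of F in the triangle would be redundant.  A propeller with k
-- blades therefore has |F| = k.  In a windmill the edges from the hub q into a blade are
-- dominated inside the blade, so the house edges of F dominate the 4-cycle p₁p₂p₃p₄ and none of
-- them is redundant among house edges; running through the 64 subsets of house edges shows that
-- there are exactly two of them, so |F| = k + 2.  Sizes are compared through the degree sum
-- 2|F|, which does not change when the vertices are relabelled by natural numbers.

open import Defs hiding (sym)
open import Data.Bool using (Bool; true; false; _∧_; _∨_; not; if_then_else_)
open import Data.Bool.Properties using (∧-identityʳ; ∧-zeroʳ; ∨-zeroʳ; ∨-comm; ∧-conicalˡ; ∧-conicalʳ)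
import Data.Bool.Properties as Bool
open import Data.Nat using (ℕ; zero; suc; _+_; _*_; _/_; _%_; _≡ᵇ_; _<ᵇ_; _<_; _≤_; _≤?_; z<s; s<s)
open import Data.Nat.DivMod
  using (m%n<n; m≡m%n+[m/n]*n; /-congˡ; m*n/n≡m; +-distrib-/-∣ˡ; +-distrib-/-∣ʳ; m<n*o⇒m/o<n)
open import Data.Nat.Divisibility using (m∣m*n; divides)
open import Data.Nat.Properties
open import Data.Nat.ListAction using (sum)
open import Data.Nat.ListAction.Properties using (sum-++)
open import Data.Fin using (Fin; toℕ; fromℕ<)
open import Data.Fin.Properties using (toℕ<n; toℕ-injective; toℕ-fromℕ<)
import Data.Fin.Properties as Fin
import Data.Fin as Fin
open import Data.List using (List; []; _∷_; map; concatMap; allFin; tabulate)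
open import Data.Vec using ([]; _∷_)
open import Data.Fin.Subset using (Subset)
open import Data.Fin.Subset.Properties using (anySubset?)
open import Data.Maybe using (Maybe; just; nothing)
import Data.Maybe as Maybe
open import Data.Product using (∃-syntax; _×_; _,_; proj₁; proj₂)
import Data.Product as Product
open import Data.Sum using (_⊎_; inj₁; inj₂; [_,_])
import Data.Sum as Sum
open import Data.Empty using (⊥-elim)
open import Function using (_∘_; id; _↔_; Inverse; mk⇔)
open import Relation.Nullary using (¬_; ¬?; Dec; yes; no; does; contradiction)
open import Relation.Nullary.Decidable
  using (_×-dec_; _⊎-dec_; _→-dec_; dec-true; dec-false; does-⇔; decidable-stable; toWitnessFalse)
open import Relation.Binary.PropositionalEquality hiding ([_])
open import Relation.Binary.Definitions using (DecidableEquality; tri<; tri≈; tri>)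
open import Algebra.Properties.CommutativeMonoid.Sum +-0-commutativeMonoid
  using (∑-comm; ∑-permute; ∑-distrib-+; sum-cong-≗) renaming (sum to ∑)
open import Data.Nat.Tactic.RingSolver using (solve-∀)

𝟙 : Bool → ℕ
𝟙 b = if b then 1 else 0

∨-true : ∀ {x y} → x ∨ y ≡ true → x ≡ true ⊎ y ≡ true
∨-true {true}  _ = inj₁ refl
∨-true {false} h = inj₂ h

does-true : ∀ {P : Set} (P? : Dec P) → does P? ≡ true → P
does-true (yes p) _  = p
does-true (no _)  ()

beyond-≢ : ∀ {s y p} → p < s → s + y ≢ p
beyond-≢ {s} {y} p<s refl = m+n≮m s y p<s

sum-map-tabulate : ∀ {A : Set} {n} (f : A → ℕ) (t : Fin n → A) → sum (map f (tabulate t)) ≡ ∑ (f ∘ t)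
sum-map-tabulate {n = zero}  f t = refl
sum-map-tabulate {n = suc n} f t = cong (f (t Fin.zero) +_) (sum-map-tabulate f (t ∘ Fin.suc))

sum-concatMap : ∀ {A : Set} (g : A → List ℕ) (xs : List A) → sum (concatMap g xs) ≡ sum (map (sum ∘ g) xs)
sum-concatMap g []       = refl
sum-concatMap g (x ∷ xs) = trans (sum-++ (g x) (concatMap g xs)) (cong (sum (g x) +_) (sum-concatMap g xs))


∑< : ℕ → (ℕ → ℕ) → ℕ
∑< n h = ∑ {n} (h ∘ toℕ)

∑<-cong : ∀ n {g h : ℕ → ℕ} → (∀ {i} → i < n → g i ≡ h i) → ∑< n g ≡ ∑< n h
∑<-cong n eq = sum-cong-≗ (eq ∘ toℕ<n)

∑<-const : ∀ n c → ∑< n (λ _ → c) ≡ n * c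
∑<-const zero    c = refl
∑<-const (suc n) c = cong (c +_) (∑<-const n c)

∑<-zero : ∀ n {h : ℕ → ℕ} → (∀ {i} → i < n → h i ≡ 0) → ∑< n h ≡ 0
∑<-zero n eq = trans (∑<-cong n eq) (trans (∑<-const n 0) (*-zeroʳ n))

∑<-distrib-+ : ∀ n (g h : ℕ → ℕ) → ∑< n (λ i → g i + h i) ≡ ∑< n g + ∑< n h
∑<-distrib-+ n g h = ∑-distrib-+ {n} (g ∘ toℕ) (h ∘ toℕ)

∑<-+ : ∀ m n (h : ℕ → ℕ) → ∑< (m + n) h ≡ ∑< m h + ∑< n (λ j → h (m + j))
∑<-+ zero    n h = refl
∑<-+ (suc m) n h = trans (cong (h 0 +_) (∑<-+ m n (h ∘ suc))) (sym (+-assoc (h 0) _ _))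

∑<-pairs : ∀ k (h : ℕ → ℕ) → ∑< (2 * k) h ≡ ∑< k (λ i → h (2 * i) + h (suc (2 * i)))
∑<-pairs zero    h = refl
∑<-pairs (suc k) h = begin
  ∑< (2 * suc k) h                                      ≡⟨ cong (λ n → ∑< n h) (*-suc 2 k) ⟩
  h 0 + (h 1 + ∑< (2 * k) (h ∘ suc ∘ suc))              ≡⟨ +-assoc (h 0) (h 1) _ ⟨
  (h 0 + h 1) + ∑< (2 * k) (h ∘ suc ∘ suc)              ≡⟨ cong ((h 0 + h 1) +_) (∑<-pairs k (h ∘ suc ∘ suc)) ⟩
  (h 0 + h 1) + ∑< k (λ i → h (2 + 2 * i) + h (3 + 2 * i))
    ≡⟨ cong ((h 0 + h 1) +_) (∑<-cong k λ {i} _ → cong₂ (λ p q → h p + h q) (*-suc 2 i) (cong suc (*-suc 2 i))) ⟨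
  ∑< (suc k) (λ i → h (2 * i) + h (suc (2 * i)))        ∎
  where open ≡-Reasoning

∑<-single : ∀ n {p} {h : ℕ → ℕ} → p < n → (∀ {i} → i ≢ p → h i ≡ 0) → ∑< n h ≡ h p
∑<-single (suc n) {zero}  {h} z<s zero-off =
  trans (cong (h 0 +_) (∑<-zero n λ {i} _ → zero-off {suc i} λ ())) (+-identityʳ (h 0))
∑<-single (suc n) {suc p} {h} (s<s p<n) zero-off =
  cong₂ _+_ (zero-off λ ()) (∑<-single n p<n (λ i≢p → zero-off (i≢p ∘ suc-injective)))

∑<-pair : ∀ n {p q} {h : ℕ → ℕ} → p ≢ q → p < n → q < n → (∀ {i} → i ≢ p → i ≢ q → h i ≡ 0) →
          ∑< n h ≡ h p + h q
∑<-pair (suc n) {zero}  {zero}  p≢q _ _ _ = contradiction refl p≢q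
∑<-pair (suc n) {zero}  {suc q} {h} _ _ (s<s q<n) zero-off =
  cong (h 0 +_) (∑<-single n q<n λ i≢q → zero-off (λ ()) (i≢q ∘ suc-injective))
∑<-pair (suc n) {suc p} {zero}  {h} _ (s<s p<n) _ zero-off =
  trans (cong (h 0 +_) (∑<-single n p<n λ i≢p → zero-off (i≢p ∘ suc-injective) (λ ()))) (+-comm (h 0) (h (suc p)))
∑<-pair (suc n) {suc p} {suc q} {h} p≢q (s<s p<n) (s<s q<n) zero-off =
  cong₂ _+_ (zero-off (λ ()) (λ ()))
            (∑<-pair n (p≢q ∘ cong suc) p<n q<n λ i≢p i≢q → zero-off (i≢p ∘ suc-injective) (i≢q ∘ suc-injective))

module _ {V : Set} where

  SameEdge : V → V → V → V → Set
  SameEdge x y u v = (x ≡ u × y ≡ v) ⊎ (x ≡ v × y ≡ u)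

  Touches : V → V → V → V → Set
  Touches x y u v = x ≡ u ⊎ x ≡ v ⊎ y ≡ u ⊎ y ≡ v

  Dominated : (V → V → Bool) → V → V → Set
  Dominated R u v = ∃[ x ] ∃[ y ] (R x y ≡ true × (x ≡ u ⊎ x ≡ v))

  DominatedBesides : (V → V → Bool) → V → V → V → V → Set
  DominatedBesides R u v x y = ∃[ x′ ] ∃[ y′ ] (R x′ y′ ≡ true × ¬ SameEdge x′ y′ u v × (x′ ≡ x ⊎ x′ ≡ y))

  SameEdge-swap : ∀ {x y u v} → SameEdge x y u v → SameEdge y x u v
  SameEdge-swap (inj₁ (x≡u , y≡v)) = inj₂ (y≡v , x≡u)
  SameEdge-swap (inj₂ (x≡v , y≡u)) = inj₁ (y≡u , x≡v)

  DominatedBesides-swap : ∀ {R u v x y} → DominatedBesides R u v x y → DominatedBesides R u v y x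
  DominatedBesides-swap (x′ , y′ , x′y′∈R , ≠uv , at) = x′ , y′ , x′y′∈R , ≠uv , Sum.swap at

  touches-if-same : ∀ {x y x′ y′ u v} → SameEdge x′ y′ u v → x′ ≡ x ⊎ x′ ≡ y → Touches x y u v
  touches-if-same (inj₁ (refl , _)) (inj₁ refl) = inj₁ refl
  touches-if-same (inj₁ (refl , _)) (inj₂ refl) = inj₂ (inj₂ (inj₁ refl))
  touches-if-same (inj₂ (refl , _)) (inj₁ refl) = inj₂ (inj₁ refl)
  touches-if-same (inj₂ (refl , _)) (inj₂ refl) = inj₂ (inj₂ (inj₂ refl))

module _ {V : Set} (_≟_ : DecidableEquality V) where

  sameEdge-dec : ∀ x y u v → Dec (SameEdge x y u v)
  sameEdge-dec x y u v = (x ≟ u ×-dec y ≟ v) ⊎-dec (x ≟ v ×-dec y ≟ u)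

  touches-dec : ∀ x y u v → Dec (Touches x y u v)
  touches-dec x y u v = x ≟ u ⊎-dec x ≟ v ⊎-dec y ≟ u ⊎-dec y ≟ v

module _ {V W : Set} (f : V → W) {x y u v : V} where

  SameEdge-map : SameEdge x y u v → SameEdge (f x) (f y) (f u) (f v)
  SameEdge-map = Sum.map (Product.map (cong f) (cong f)) (Product.map (cong f) (cong f))

  Touches-map : Touches x y u v → Touches (f x) (f y) (f u) (f v)
  Touches-map = Sum.map (cong f) (Sum.map (cong f) (Sum.map (cong f) (cong f)))

-- Minimal edge dominating sets and the handshake lemma

module _ {G : Graph} where

  private
    V = Fin (n G)

  sameEdge? : (x y u v : V) → Dec (SameEdge x y u v)
  sameEdge? = sameEdge-dec Fin._≟_

  sameEdge?-swap : ∀ x y u v → does (sameEdge? x y u v) ≡ does (sameEdge? y x u v)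
  sameEdge?-swap x y u v = does-⇔ (mk⇔ SameEdge-swap SameEdge-swap) (sameEdge? x y u v) (sameEdge? y x u v)

  without : EdgeSet G → V → V → EdgeSet G
  mem  (without F u v) x y = mem F x y ∧ not (does (sameEdge? x y u v))
  msym (without F u v) x y = cong₂ (λ p q → p ∧ not q) (msym F x y) (sameEdge?-swap x y u v)
  sub  (without F u v) x y xy∈ = sub F x y (∧-conicalˡ _ _ xy∈)

  minimal⇒irredundant : ∀ {F : EdgeSet G} {u v} → IsMinimalEDS F → mem F u v ≡ true →
    ¬ (∀ x y → adj G x y ≡ true → Touches x y u v → DominatedBesides (mem F) u v x y)
  minimal⇒irredundant {F} {u} {v} (eds , minimal) uv∈F covered =
    uv∉F-uv (minimal (without F u v) (λ x y → ∧-conicalˡ _ _) eds-uv u v uv∈F)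
    where
    uv∉F-uv : mem (without F u v) u v ≢ true
    uv∉F-uv uv∈ = contradiction (∧-conicalʳ _ _ uv∈) (subst (λ b → not b ≢ true)
                    (sym (dec-true (sameEdge? u v u v) (inj₁ (refl , refl)))) λ ())
    kept : ∀ {x y} → mem F x y ≡ true → ¬ SameEdge x y u v → mem (without F u v) x y ≡ true
    kept {x} {y} xy∈F ≠uv rewrite xy∈F | dec-false (sameEdge? x y u v) ≠uv = refl
    eds-uv : IsEDS (without F u v)
    eds-uv x y xy with eds x y xy
    ... | x′ , y′ , x′y′∈F , at with sameEdge? x′ y′ u v
    ...   | no ≠uv = x′ , y′ , kept x′y′∈F ≠uv , at
    ...   | yes same with covered x y xy (touches-if-same same at)
    ...     | x″ , y″ , x″y″∈F , ≠uv , at′ = x″ , y″ , kept x″y″∈F ≠uv , at′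

  module _ (F : EdgeSet G) where

    degreeSum : ℕ
    degreeSum = ∑ λ u → ∑ λ v → 𝟙 (mem F u v)

    private
      upper : V → V → ℕ
      upper u v = 𝟙 (mem F u v ∧ (toℕ u <ᵇ toℕ v))

      size-∑ : size F ≡ ∑ λ u → ∑ λ v → upper u v
      size-∑ = begin
        size F                                                ≡⟨ sum-concatMap row (allFin (n G)) ⟩
        sum (map (sum ∘ row) (allFin (n G)))                  ≡⟨ sum-map-tabulate (sum ∘ row) id ⟩
        ∑ (sum ∘ row)                                         ≡⟨ sum-cong-≗ (λ u → sum-map-tabulate (upper u) id) ⟩
        (∑ λ u → ∑ λ v → upper u v)                           ∎
        where
        open ≡-Reasoning
        row : V → List ℕ
        row u = map (upper u) (allFin (n G))

      loopless : ∀ u → mem F u u ≡ false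
      loopless u with mem F u u in uu∈F
      ... | false = refl
      ... | true  = contradiction (trans (sym (sub F u u uu∈F)) (irrefl G u)) λ ()

      𝟙-split : ∀ u v → 𝟙 (mem F u v) ≡ upper u v + upper v u
      𝟙-split u v with <-cmp (toℕ u) (toℕ v)
      ... | tri< u<v _ v≮u
        rewrite dec-true (toℕ u <? toℕ v) u<v | dec-false (toℕ v <? toℕ u) v≮u
              | ∧-identityʳ (mem F u v) | ∧-zeroʳ (mem F v u) = sym (+-identityʳ _)
      ... | tri> u≮v _ v<u
        rewrite dec-false (toℕ u <? toℕ v) u≮v | dec-true (toℕ v <? toℕ u) v<u
              | ∧-zeroʳ (mem F u v) | ∧-identityʳ (mem F v u) = cong 𝟙 (msym F u v)
      ... | tri≈ _ u≡v _ rewrite toℕ-injective u≡v | loopless v = refl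

    handshake : degreeSum ≡ 2 * size F
    handshake = begin
      (∑ λ u → ∑ λ v → 𝟙 (mem F u v))
        ≡⟨ sum-cong-≗ (λ u → trans (sum-cong-≗ (𝟙-split u)) (∑-distrib-+ (upper u) (λ v → upper v u))) ⟩
      (∑ λ u → (∑ λ v → upper u v) + (∑ λ v → upper v u))
        ≡⟨ ∑-distrib-+ (λ u → ∑ (upper u)) (λ u → ∑ λ v → upper v u) ⟩
      (∑ λ u → ∑ λ v → upper u v) + (∑ λ u → ∑ λ v → upper v u)
        ≡⟨ cong ((∑ λ u → ∑ (upper u)) +_) (∑-comm (λ u v → upper v u)) ⟩
      (∑ λ u → ∑ λ v → upper u v) + (∑ λ v → ∑ λ u → upper v u)
        ≡⟨ cong₂ _+_ size-∑ (trans (+-identityʳ (size F)) size-∑) ⟨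
      size F + (size F + 0) ∎
      where open ≡-Reasoning

-- A minimal edge dominating set of the graph on 0, …, m-1 with adjacency A; the values of A
-- outside that range are irrelevant (propellerAdjℕ 0 b, for instance, is true for every b).
record MinimalEDSᴺ (m : ℕ) (A : ℕ → ℕ → Bool) : Set where
  field
    F           : ℕ → ℕ → Bool
    F-sym       : ∀ a b → F a b ≡ F b a
    F⊆A         : ∀ {a b} → F a b ≡ true → A a b ≡ true
    dominating  : ∀ {a b} → a < m → b < m → A a b ≡ true → Dominated F a b
    irredundant : ∀ {a b} → F a b ≡ true →
                  ¬ (∀ {c d} → c < m → d < m → A c d ≡ true → Touches c d a b → DominatedBesides F a b c d)

  degreeSumᴺ : ℕ
  degreeSumᴺ = ∑< m λ a → ∑< m λ b → 𝟙 (F a b)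

  F-nonedge : ∀ {a b} → A a b ≡ false → F a b ≡ false
  F-nonedge {a} {b} ab∉A with F a b in ab∈F
  ... | false = refl
  ... | true  = contradiction (trans (sym (F⊆A ab∈F)) ab∉A) λ ()

fin? : (m : ℕ) → ℕ → Maybe (Fin m)
fin? zero    _       = nothing
fin? (suc m) zero    = just Fin.zero
fin? (suc m) (suc a) = Maybe.map Fin.suc (fin? m a)

fin?-toℕ : ∀ {m} (x : Fin m) → fin? m (toℕ x) ≡ just x
fin?-toℕ {suc m} Fin.zero    = refl
fin?-toℕ {suc m} (Fin.suc x) rewrite fin?-toℕ x = refl

fin?-just : ∀ m a {x} → fin? m a ≡ just x → toℕ x ≡ a
fin?-just (suc m) zero    refl = refl
fin?-just (suc m) (suc a) eq with fin? m a in a↦y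
fin?-just (suc m) (suc a) refl | just y = cong suc (fin?-just m a a↦y)

module _ {X : Set} (R : X → X → Bool) where

  lift₂ : Maybe X → Maybe X → Bool
  lift₂ (just x) (just y) = R x y
  lift₂ _        _        = false

  lift₂-true : ∀ mx my → lift₂ mx my ≡ true → ∃[ x ] ∃[ y ] (mx ≡ just x × my ≡ just y × R x y ≡ true)
  lift₂-true (just x) (just y) xy∈R = x , y , refl , refl , xy∈R

  lift₂-sym : (∀ x y → R x y ≡ R y x) → ∀ mx my → lift₂ mx my ≡ lift₂ my mx
  lift₂-sym R-sym (just x) (just y) = R-sym x y
  lift₂-sym R-sym (just x) nothing  = refl
  lift₂-sym R-sym nothing  (just y) = refl
  lift₂-sym R-sym nothing  nothing  = refl

module Labelling {G : Graph} {m : ℕ} {A : ℕ → ℕ → Bool} (ι : Fin (n G) ↔ Fin m)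
                 (ι-adj : ∀ u v → adj G u v ≡ A (toℕ (Inverse.to ι u)) (toℕ (Inverse.to ι v))) where

  private
    V = Fin (n G)
  open Inverse ι using (to; from; strictlyInverseˡ; strictlyInverseʳ)

  label : V → ℕ
  label = toℕ ∘ to

  label-injective : ∀ {u v} → label u ≡ label v → u ≡ v
  label-injective {u} {v} eq = begin
    u           ≡⟨ strictlyInverseʳ u ⟨
    from (to u) ≡⟨ cong from (toℕ-injective eq) ⟩
    from (to v) ≡⟨ strictlyInverseʳ v ⟩
    v           ∎
    where open ≡-Reasoning

  vertex : ∀ {a} → a < m → V
  vertex a<m = from (fromℕ< a<m)

  label-vertex : ∀ {a} (a<m : a < m) → label (vertex a<m) ≡ a
  label-vertex a<m = trans (cong toℕ (strictlyInverseˡ _)) (toℕ-fromℕ< a<m)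

  relabel : (V → V → Bool) → ℕ → ℕ → Bool
  relabel R a b = lift₂ (λ x y → R (from x) (from y)) (fin? m a) (fin? m b)

  relabel-toℕ : ∀ R x y → relabel R (toℕ x) (toℕ y) ≡ R (from x) (from y)
  relabel-toℕ R x y rewrite fin?-toℕ x | fin?-toℕ y = refl

  relabel-label : ∀ R u v → relabel R (label u) (label v) ≡ R u v
  relabel-label R u v = trans (relabel-toℕ R (to u) (to v)) (cong₂ R (strictlyInverseʳ u) (strictlyInverseʳ v))

  relabel-true : ∀ {R a b} → relabel R a b ≡ true → ∃[ u ] ∃[ v ] (a ≡ label u × b ≡ label v × R u v ≡ true)
  relabel-true {R} {a} {b} ab∈ with lift₂-true _ (fin? m a) (fin? m b) ab∈
  ... | x , y , a↦x , b↦y , xy∈R = from x , from y , labelled a↦x , labelled b↦y , xy∈R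
    where
    labelled : ∀ {c z} → fin? m c ≡ just z → c ≡ label (from z)
    labelled {c} {z} c↦z = trans (sym (fin?-just m c c↦z)) (cong toℕ (sym (strictlyInverseˡ z)))

  ∑-relabel : (f : V → ℕ) → ∑ {m} (f ∘ from) ≡ ∑ {n G} f
  ∑-relabel f = trans (∑-permute (f ∘ from) ι) (sum-cong-≗ (cong f ∘ strictlyInverseʳ))

  module _ (F : EdgeSet G) (minimal : IsMinimalEDS F) where

    private
      Fᴺ = relabel (mem F)

    relabel-dominating : ∀ {a b} → a < m → b < m → A a b ≡ true → Dominated Fᴺ a b
    relabel-dominating a<m b<m ab∈A with proj₁ minimal (vertex a<m) (vertex b<m) uv∈G
      where
      uv∈G : adj G (vertex a<m) (vertex b<m) ≡ true
      uv∈G = trans (ι-adj _ _) (subst₂ (λ a b → A a b ≡ true) (sym (label-vertex a<m)) (sym (label-vertex b<m)) ab∈A)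
    ... | x , y , xy∈F , at = label x , label y , trans (relabel-label (mem F) x y) xy∈F ,
                              Sum.map (λ x≡u → trans (cong label x≡u) (label-vertex a<m))
                                      (λ x≡v → trans (cong label x≡v) (label-vertex b<m)) at

    unlabel : ∀ {u v x y} → DominatedBesides Fᴺ (label u) (label v) (label x) (label y) →
              DominatedBesides (mem F) u v x y
    unlabel (_ , _ , ee′∈ , ≠uv , at) with relabel-true {mem F} ee′∈
    ... | x′ , y′ , refl , refl , x′y′∈F =
      x′ , y′ , x′y′∈F , ≠uv ∘ SameEdge-map label , Sum.map label-injective label-injective at

    relabel-irredundant : ∀ {a b} → Fᴺ a b ≡ true →
      ¬ (∀ {c d} → c < m → d < m → A c d ≡ true → Touches c d a b → DominatedBesides Fᴺ a b c d)
    relabel-irredundant ab∈ covered with relabel-true {mem F} ab∈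
    ... | u , v , refl , refl , uv∈F = minimal⇒irredundant {F = F} minimal uv∈F λ x y xy∈G touch →
      unlabel (covered (toℕ<n (to x)) (toℕ<n (to y)) (trans (sym (ι-adj x y)) xy∈G) (Touches-map label touch))

    minimalEDSᴺ : MinimalEDSᴺ m A
    minimalEDSᴺ = record
      { F           = Fᴺ
      ; F-sym       = λ a b → lift₂-sym (λ x y → mem F (from x) (from y)) (λ x y → msym F (from x) (from y))
                                          (fin? m a) (fin? m b)
      ; F⊆A         = λ ab∈ → let (u , v , a≡ , b≡ , uv∈F) = relabel-true {mem F} ab∈ in
                        subst₂ (λ a b → A a b ≡ true) (sym a≡) (sym b≡) (trans (sym (ι-adj u v)) (sub F u v uv∈F))
      ; dominating  = relabel-dominating
      ; irredundant = relabel-irredundant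
      }

    degreeSum-relabel : MinimalEDSᴺ.degreeSumᴺ minimalEDSᴺ ≡ degreeSum F
    degreeSum-relabel = begin
      (∑ {m} λ x → ∑ {m} λ y → 𝟙 (Fᴺ (toℕ x) (toℕ y)))
        ≡⟨ sum-cong-≗ (λ x → sum-cong-≗ λ y → cong 𝟙 (relabel-toℕ (mem F) x y)) ⟩
      (∑ {m} λ x → ∑ {m} λ y → 𝟙 (mem F (from x) (from y)))
        ≡⟨ sum-cong-≗ (λ x → ∑-relabel λ v → 𝟙 (mem F (from x) v)) ⟩
      (∑ {m} λ x → ∑ {n G} λ v → 𝟙 (mem F (from x) v))
        ≡⟨ ∑-relabel (λ u → ∑ λ v → 𝟙 (mem F u v)) ⟩
      degreeSum F ∎
      where open ≡-Reasoning

  wellEdgeDominated-if-degreeSum-constant : ∀ N → (∀ (M : MinimalEDSᴺ m A) → MinimalEDSᴺ.degreeSumᴺ M ≡ N) →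
                                            WellEdgeDominated G
  wellEdgeDominated-if-degreeSum-constant N constant F F′ minimal minimal′ =
    *-cancelˡ-≡ (size F) (size F′) 2 (begin
    2 * size F                                       ≡⟨ handshake F ⟨
    degreeSum F                                      ≡⟨ degreeSum-relabel F minimal ⟨
    MinimalEDSᴺ.degreeSumᴺ (minimalEDSᴺ F minimal)   ≡⟨ constant (minimalEDSᴺ F minimal) ⟩
    N                                                ≡⟨ constant (minimalEDSᴺ F′ minimal′) ⟨
    MinimalEDSᴺ.degreeSumᴺ (minimalEDSᴺ F′ minimal′) ≡⟨ degreeSum-relabel F′ minimal′ ⟩
    degreeSum F′                                     ≡⟨ handshake F′ ⟩
    2 * size F′                                      ∎)
    where open ≡-Reasoning

-- Pendant triangles

record PendantTriangle (A : ℕ → ℕ → Bool) (z a b : ℕ) : Set where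
  field
    z≢a    : z ≢ a
    z≢b    : z ≢ b
    a≢b    : a ≢ b
    ab∈A   : A a b ≡ true
    a-nbrs : ∀ {d} → A a d ≡ true → d ≡ z ⊎ d ≡ b
    b-nbrs : ∀ {d} → A b d ≡ true → d ≡ z ⊎ d ≡ a

module _ {m A} (M : MinimalEDSᴺ m A) (A-sym : ∀ a b → A a b ≡ A b a) where

  open MinimalEDSᴺ M

  row : ℕ → ℕ
  row x = ∑< m λ d → 𝟙 (F x d)

  𝟙-off-neighbours : ∀ {x p q} → (∀ {d} → A x d ≡ true → d ≡ p ⊎ d ≡ q) → ∀ {d} → d ≢ p → d ≢ q → 𝟙 (F x d) ≡ 0
  𝟙-off-neighbours {x} nbrs {d} d≢p d≢q with F x d in xd∈F
  ... | false = refl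
  ... | true  = contradiction (nbrs (F⊆A xd∈F)) [ d≢p , d≢q ]

  not-shadowed : ∀ {a b p q} → F a b ≡ true → F p q ≡ true → ¬ SameEdge p q a b →
                 ¬ (∀ {c d} → A c d ≡ true → Touches c d a b → Touches c d p q)
  not-shadowed {a} {b} {p} {q} ab∈F pq∈F ≠ab shadow =
    irredundant ab∈F λ _ _ cd∈A touch → dominated (shadow cd∈A touch)
    where
    qp∈F : F q p ≡ true
    qp∈F = trans (F-sym q p) pq∈F
    dominated : ∀ {c d} → Touches c d p q → DominatedBesides F a b c d
    dominated (inj₁ c≡p)               = p , q , pq∈F , ≠ab , inj₁ (sym c≡p)
    dominated (inj₂ (inj₁ c≡q))        = q , p , qp∈F , ≠ab ∘ SameEdge-swap , inj₁ (sym c≡q)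
    dominated (inj₂ (inj₂ (inj₁ d≡p))) = p , q , pq∈F , ≠ab , inj₂ (sym d≡p)
    dominated (inj₂ (inj₂ (inj₂ d≡q))) = q , p , qp∈F , ≠ab ∘ SameEdge-swap , inj₂ (sym d≡q)

  touches-via : ∀ {x u v c d} → (∀ {e} → A x e ≡ true → e ≡ u ⊎ e ≡ v) → A c d ≡ true → c ≡ x ⊎ d ≡ x →
                Touches c d u v
  touches-via nbrs cd∈A (inj₁ refl) = [ inj₂ ∘ inj₂ ∘ inj₁ , inj₂ ∘ inj₂ ∘ inj₂ ] (nbrs cd∈A)
  touches-via nbrs cd∈A (inj₂ refl) = [ inj₁ , inj₂ ∘ inj₁ ] (nbrs (trans (A-sym _ _) cd∈A))

  module Triangle {z a b} (T : PendantTriangle A z a b) (z<m : z < m) (a<m : a < m) (b<m : b < m) where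

    open PendantTriangle T

    triangle-dominated : F z a ≡ true ⊎ F z b ≡ true ⊎ F a b ≡ true
    triangle-dominated with dominating a<m b<m ab∈A
    ... | _ , d , ad∈F , inj₁ refl = [ (λ { refl → inj₁ (trans (F-sym z a) ad∈F) }) , (λ { refl → inj₂ (inj₂ ad∈F) }) ]
                                       (a-nbrs (F⊆A ad∈F))
    ... | _ , d , bd∈F , inj₂ refl = [ (λ { refl → inj₂ (inj₁ (trans (F-sym z b) bd∈F)) })
                                     , (λ { refl → inj₂ (inj₂ (trans (F-sym a b) bd∈F)) }) ] (b-nbrs (F⊆A bd∈F))

    zb⊑za : ∀ {c d} → A c d ≡ true → Touches c d z b → Touches c d z a
    zb⊑za cd∈A (inj₁ c≡z)               = inj₁ c≡z
    zb⊑za cd∈A (inj₂ (inj₁ c≡b))        = touches-via b-nbrs cd∈A (inj₁ c≡b)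
    zb⊑za cd∈A (inj₂ (inj₂ (inj₁ d≡z))) = inj₂ (inj₂ (inj₁ d≡z))
    zb⊑za cd∈A (inj₂ (inj₂ (inj₂ d≡b))) = touches-via b-nbrs cd∈A (inj₂ d≡b)

    ab⊑za : ∀ {c d} → A c d ≡ true → Touches c d a b → Touches c d z a
    ab⊑za cd∈A (inj₁ c≡a)               = inj₂ (inj₁ c≡a)
    ab⊑za cd∈A (inj₂ (inj₁ c≡b))        = touches-via b-nbrs cd∈A (inj₁ c≡b)
    ab⊑za cd∈A (inj₂ (inj₂ (inj₁ d≡a))) = inj₂ (inj₂ (inj₂ d≡a))
    ab⊑za cd∈A (inj₂ (inj₂ (inj₂ d≡b))) = touches-via b-nbrs cd∈A (inj₂ d≡b)

    ab⊑zb : ∀ {c d} → A c d ≡ true → Touches c d a b → Touches c d z b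
    ab⊑zb cd∈A (inj₁ c≡a)               = touches-via a-nbrs cd∈A (inj₁ c≡a)
    ab⊑zb cd∈A (inj₂ (inj₁ c≡b))        = inj₂ (inj₁ c≡b)
    ab⊑zb cd∈A (inj₂ (inj₂ (inj₁ d≡a))) = touches-via a-nbrs cd∈A (inj₂ d≡a)
    ab⊑zb cd∈A (inj₂ (inj₂ (inj₂ d≡b))) = inj₂ (inj₂ (inj₂ d≡b))

    triangle-exactly-one : 𝟙 (F z a) + 𝟙 (F z b) + 𝟙 (F a b) ≡ 1
    triangle-exactly-one with F z a in za∈F | F z b in zb∈F | F a b in ab∈F
    ... | true  | true  | _     = ⊥-elim (not-shadowed zb∈F za∈F [ a≢b ∘ proj₂ , z≢b ∘ proj₁ ] zb⊑za)
    ... | true  | false | true  = ⊥-elim (not-shadowed ab∈F za∈F [ z≢a ∘ proj₁ , z≢b ∘ proj₁ ] ab⊑za)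
    ... | false | true  | true  = ⊥-elim (not-shadowed ab∈F zb∈F [ z≢a ∘ proj₁ , z≢b ∘ proj₁ ] ab⊑zb)
    ... | true  | false | false = refl
    ... | false | true  | false = refl
    ... | false | false | true  = refl
    ... | false | false | false with triangle-dominated
    ...   | inj₁ za∈        = contradiction (trans (sym za∈F) za∈) λ ()
    ...   | inj₂ (inj₁ zb∈) = contradiction (trans (sym zb∈F) zb∈) λ ()
    ...   | inj₂ (inj₂ ab∈) = contradiction (trans (sym ab∈F) ab∈) λ ()

    triangle-rows : (𝟙 (F z a) + 𝟙 (F z b)) + (row a + row b) ≡ 2
    triangle-rows = begin
      (𝟙 (F z a) + 𝟙 (F z b)) + (row a + row b)
        ≡⟨ cong ((𝟙 (F z a) + 𝟙 (F z b)) +_) (cong₂ _+_ row-a row-b) ⟩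
      (𝟙 (F z a) + 𝟙 (F z b)) + ((𝟙 (F z a) + 𝟙 (F a b)) + (𝟙 (F z b) + 𝟙 (F a b)))
        ≡⟨ double (𝟙 (F z a)) (𝟙 (F z b)) (𝟙 (F a b)) ⟩
      2 * (𝟙 (F z a) + 𝟙 (F z b) + 𝟙 (F a b))
        ≡⟨ cong (2 *_) triangle-exactly-one ⟩
      2 ∎
      where
      open ≡-Reasoning
      double : ∀ x y w → (x + y) + ((x + w) + (y + w)) ≡ 2 * (x + y + w)
      double = solve-∀
      row-a : row a ≡ 𝟙 (F z a) + 𝟙 (F a b)
      row-a = trans (∑<-pair m z≢b z<m b<m (𝟙-off-neighbours a-nbrs)) (cong (_+ _) (cong 𝟙 (F-sym a z)))
      row-b : row b ≡ 𝟙 (F z b) + 𝟙 (F a b)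
      row-b = trans (∑<-pair m z≢a z<m a<m (𝟙-off-neighbours b-nbrs))
                    (cong₂ _+_ (cong 𝟙 (F-sym b z)) (cong 𝟙 (F-sym b a)))

    outside-avoids : ∀ {p q} → (∀ {e} → e ≡ a ⊎ e ≡ b → e ≢ p × e ≢ q) →
                     ∀ {e e′} → e′ ≡ a ⊎ e′ ≡ b → ¬ SameEdge e e′ p q
    outside-avoids outside e′∈ab = [ proj₂ (outside e′∈ab) ∘ proj₂ , proj₁ (outside e′∈ab) ∘ proj₂ ]

    spoke-dominated : ∀ {x p q} → x ≡ a ⊎ x ≡ b → (∀ {e} → e ≡ a ⊎ e ≡ b → e ≢ p × e ≢ q) →
                      DominatedBesides F p q z x
    spoke-dominated x∈ab outside with triangle-dominated
    ... | inj₁ za∈F        = z , a , za∈F , outside-avoids outside (inj₁ refl) , inj₁ refl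
    ... | inj₂ (inj₁ zb∈F) = z , b , zb∈F , outside-avoids outside (inj₂ refl) , inj₁ refl
    ... | inj₂ (inj₂ ab∈F) with x∈ab
    ...   | inj₁ refl = a , b , ab∈F , outside-avoids outside (inj₂ refl) , inj₂ refl
    ...   | inj₂ refl = b , a , trans (F-sym b a) ab∈F , outside-avoids outside (inj₁ refl) , inj₂ refl

-- Blades

halves : ∀ y → y ≡ 2 * (y / 2) ⊎ y ≡ suc (2 * (y / 2))
halves y with y % 2 | m%n<n y 2 | m≡m%n+[m/n]*n y 2
... | 0 | _ | y≡ = inj₁ (trans y≡ (*-comm (y / 2) 2))
... | 1 | _ | y≡ = inj₂ (trans y≡ (cong suc (*-comm (y / 2) 2)))
... | suc (suc _) | s<s (s<s ()) | _

double/2 : ∀ i → 2 * i / 2 ≡ i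
double/2 i = trans (/-congˡ (*-comm 2 i)) (m*n/n≡m i 2)

suc-double/2 : ∀ i → suc (2 * i) / 2 ≡ i
suc-double/2 i = trans (+-distrib-/-∣ʳ 1 {2 * i} (m∣m*n i)) (double/2 i)

twin-of-even : ∀ {i y} → y / 2 ≡ 2 * i / 2 → y ≢ 2 * i → y ≡ suc (2 * i)
twin-of-even {i} {y} half y≢ with trans half (double/2 i) | halves y
... | refl | inj₁ y≡ = contradiction y≡ y≢
... | refl | inj₂ y≡ = y≡

twin-of-odd : ∀ {i y} → y / 2 ≡ suc (2 * i) / 2 → y ≢ suc (2 * i) → y ≡ 2 * i
twin-of-odd {i} {y} half y≢ with trans half (suc-double/2 i) | halves y
... | refl | inj₁ y≡ = y≡
... | refl | inj₂ y≡ = contradiction y≡ y≢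

twins-pendant : ∀ {A s} →
  (∀ i → A (suc s + 2 * i) (suc s + suc (2 * i)) ≡ true) →
  (∀ x {d} → A (suc s + x) d ≡ true → d ≡ 0 ⊎ ∃[ y ] (d ≡ suc s + y × y / 2 ≡ x / 2 × y ≢ x)) →
  ∀ i → PendantTriangle A 0 (suc s + 2 * i) (suc s + suc (2 * i))
twins-pendant {A} {s} twins nbrs i = record
  { z≢a    = λ ()
  ; z≢b    = λ ()
  ; a≢b    = even≢odd i i ∘ +-cancelˡ-≡ (suc s) _ _
  ; ab∈A   = twins i
  ; a-nbrs = Sum.map₂ (λ { (y , refl , half , y≢) → cong (suc s +_) (twin-of-even {i} half y≢) }) ∘ nbrs (2 * i)
  ; b-nbrs = Sum.map₂ (λ { (y , refl , half , y≢) → cong (suc s +_) (twin-of-odd {i} half y≢) }) ∘ nbrs (suc (2 * i))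
  }

below-or-beyond : ∀ s d → d < s ⊎ ∃[ y ] d ≡ s + y
below-or-beyond zero    d       = inj₂ (d , refl)
below-or-beyond (suc s) zero    = inj₁ z<s
below-or-beyond (suc s) (suc d) = Sum.map s<s (Product.map₂ (cong suc)) (below-or-beyond s d)

-- Vertices 0, …, c form the core around the hub 0, and blade i is the pendant triangle on
-- 0, c+1+2i, c+2+2i.
module Blades {c k A} (M : MinimalEDSᴺ (suc c + 2 * k) A) (A-sym : ∀ a b → A a b ≡ A b a)
              (triangle : ∀ i → PendantTriangle A 0 (suc c + 2 * i) (suc c + suc (2 * i)))
              (core-isolated : ∀ {p} y → p < c → A (suc p) (suc c + y) ≡ false) where

  open MinimalEDSᴺ M

  private
    m = suc c + 2 * k

  twin<m : ∀ {i} → i < k → suc c + suc (2 * i) < m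
  twin<m {i} i<k = +-monoʳ-< (suc c) (subst (_≤ 2 * k) (*-suc 2 i) (*-monoʳ-≤ 2 i<k))

  module Blade {i} (i<k : i < k) =
    Triangle M A-sym (triangle i) z<s (<-trans (+-monoʳ-< (suc c) (n<1+n (2 * i))) (twin<m i<k)) (twin<m i<k)

  coreSum : ℕ
  coreSum = ∑< (suc c) λ p → ∑< (suc c) λ q → 𝟙 (F p q)

  spokes : ℕ → ℕ
  spokes p = ∑< (2 * k) λ j → 𝟙 (F p (suc c + j))

  core-rows : ∑< (suc c) (row M A-sym) ≡ coreSum + spokes 0
  core-rows = begin
    ∑< (suc c) (row M A-sym)
      ≡⟨ ∑<-cong (suc c) (λ {p} _ → ∑<-+ (suc c) (2 * k) λ q → 𝟙 (F p q)) ⟩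
    ∑< (suc c) (λ p → ∑< (suc c) (λ q → 𝟙 (F p q)) + spokes p)
      ≡⟨ ∑<-distrib-+ (suc c) (λ p → ∑< (suc c) λ q → 𝟙 (F p q)) spokes ⟩
    coreSum + (spokes 0 + ∑< c (spokes ∘ suc))
      ≡⟨ cong (λ t → coreSum + (spokes 0 + t)) (∑<-zero c λ p<c → ∑<-zero (2 * k) λ {j} _ →
           cong 𝟙 (F-nonedge (core-isolated j p<c))) ⟩
    coreSum + (spokes 0 + 0)
      ≡⟨ cong (coreSum +_) (+-identityʳ (spokes 0)) ⟩
    coreSum + spokes 0 ∎
    where open ≡-Reasoning

  degreeSum-blades : degreeSumᴺ ≡ coreSum + k * 2
  degreeSum-blades = begin
    ∑< (suc c + 2 * k) row′
      ≡⟨ ∑<-+ (suc c) (2 * k) row′ ⟩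
    ∑< (suc c) row′ + ∑< (2 * k) (λ j → row′ (suc c + j))
      ≡⟨ cong₂ _+_ core-rows (∑<-pairs k λ j → row′ (suc c + j)) ⟩
    (coreSum + spokes 0) + ∑< k bladeRows
      ≡⟨ +-assoc coreSum (spokes 0) _ ⟩
    coreSum + (spokes 0 + ∑< k bladeRows)
      ≡⟨ cong (λ t → coreSum + (t + ∑< k bladeRows)) (∑<-pairs k λ j → 𝟙 (F 0 (suc c + j))) ⟩
    coreSum + (∑< k bladeSpokes + ∑< k bladeRows)
      ≡⟨ cong (coreSum +_) (∑<-distrib-+ k bladeSpokes bladeRows) ⟨
    coreSum + ∑< k (λ i → bladeSpokes i + bladeRows i)
      ≡⟨ cong (coreSum +_) (∑<-cong k λ i<k → Blade.triangle-rows i<k) ⟩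
    coreSum + ∑< k (λ _ → 2)
      ≡⟨ cong (coreSum +_) (∑<-const k 2) ⟩
    coreSum + k * 2 ∎
    where
    open ≡-Reasoning
    row′ = row M A-sym
    bladeSpokes bladeRows : ℕ → ℕ
    bladeSpokes i = 𝟙 (F 0 (suc c + 2 * i)) + 𝟙 (F 0 (suc c + suc (2 * i)))
    bladeRows i = row′ (suc c + 2 * i) + row′ (suc c + suc (2 * i))

  hub-only : ∀ {p y} → p < suc c → A p (suc c + y) ≡ true → p ≡ 0
  hub-only {zero}  _         _    = refl
  hub-only {suc p} {y} (s<s p<c) py∈A = contradiction (trans (sym py∈A) (core-isolated y p<c)) λ ()

  core-neighbour : ∀ {p d} → p < c → A (suc p) d ≡ true → d < suc c
  core-neighbour {p} {d} p<c pd∈A with below-or-beyond (suc c) d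
  ... | inj₁ d<         = d<
  ... | inj₂ (y , refl) = contradiction (trans (sym pd∈A) (core-isolated y p<c)) λ ()

  spoke-dominated : ∀ {y p q} → suc c + y < m → p < suc c → q < suc c →
                    DominatedBesides F p q 0 (suc c + y)
  spoke-dominated {y} {p} {q} y<m p<core q<core =
    Blade.spoke-dominated i<k (Sum.map (cong (suc c +_)) (cong (suc c +_)) (halves y)) outside
    where
    i<k : y / 2 < k
    i<k = m<n*o⇒m/o<n (subst (y <_) (*-comm 2 k) (+-cancelˡ-< (suc c) y (2 * k) y<m))
    outside : ∀ {e} → e ≡ suc c + 2 * (y / 2) ⊎ e ≡ suc c + suc (2 * (y / 2)) → e ≢ p × e ≢ q
    outside (inj₁ refl) = beyond-≢ p<core , beyond-≢ q<core
    outside (inj₂ refl) = beyond-≢ p<core , beyond-≢ q<core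

-- The propeller

propeller-sym : ∀ a b → propellerAdjℕ a b ≡ propellerAdjℕ b a
propeller-sym zero    zero    = refl
propeller-sym zero    (suc b) = refl
propeller-sym (suc a) zero    = refl
propeller-sym (suc a) (suc b) =
  cong₂ (λ p q → p ∧ not q) (does-⇔ (mk⇔ sym sym) (a / 2 ≟ b / 2) (b / 2 ≟ a / 2))
                            (does-⇔ (mk⇔ sym sym) (a ≟ b) (b ≟ a))

propeller-twins : ∀ i → propellerAdjℕ (suc (2 * i)) (suc (suc (2 * i))) ≡ true
propeller-twins i = cong₂ (λ p q → p ∧ not q)
  (dec-true (2 * i / 2 ≟ suc (2 * i) / 2) (trans (double/2 i) (sym (suc-double/2 i))))
  (dec-false (2 * i ≟ suc (2 * i)) (even≢odd i i))

propeller-nbrs : ∀ x {d} → propellerAdjℕ (suc x) d ≡ true → d ≡ 0 ⊎ ∃[ y ] (d ≡ suc y × y / 2 ≡ x / 2 × y ≢ x)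
propeller-nbrs x {zero}  _     = inj₁ refl
propeller-nbrs x {suc y} xy∈P = inj₂ (y , refl , sym (does-true (x / 2 ≟ y / 2) (∧-conicalˡ _ _ xy∈P)) , y≢x)
  where
  y≢x : y ≢ x
  y≢x refl = contradiction (trans (cong not (sym (dec-true (x ≟ x) refl))) (∧-conicalʳ _ _ xy∈P)) λ ()

propeller-degreeSum : ∀ k (M : MinimalEDSᴺ (1 + 2 * k) propellerAdjℕ) → MinimalEDSᴺ.degreeSumᴺ M ≡ k * 2
propeller-degreeSum k M = trans degreeSum-blades (cong (_+ k * 2) hub-loopless)
  where
  open MinimalEDSᴺ M
  open Blades {c = 0} {k} M propeller-sym (twins-pendant propeller-twins propeller-nbrs) (λ _ ())
  hub-loopless : coreSum ≡ 0
  hub-loopless rewrite F-nonedge {0} {0} refl = refl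

-- The windmill

windmill-sym : ∀ a b → windmillAdjℕ a b ≡ windmillAdjℕ b a
windmill-sym a b = ∨-comm (windmillEdge a b) (windmillEdge b a)

windmillEdge-blades : ∀ x y → windmillEdge (5 + x) (5 + y) ≡ (x <ᵇ y) ∧ (x / 2 ≡ᵇ y / 2)
windmillEdge-blades x y = cong₂ (λ p q → (x <ᵇ y) ∧ (p ≡ᵇ q)) (half+3 x) (half+3 y)
  where
  half+3 : ∀ x → (5 + x + 1) / 2 ≡ 3 + x / 2
  half+3 x = trans (/-congˡ {o = 2} (+-comm (5 + x) 1)) (+-distrib-/-∣ˡ {6} x {2} (divides 3 refl))

windmill-twins : ∀ i → windmillAdjℕ (5 + 2 * i) (5 + suc (2 * i)) ≡ true
windmill-twins i = cong (_∨ windmillEdge (5 + suc (2 * i)) (5 + 2 * i))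
  (trans (windmillEdge-blades (2 * i) (suc (2 * i)))
         (cong₂ _∧_ (dec-true (2 * i <? suc (2 * i)) (n<1+n (2 * i)))
                    (dec-true (2 * i / 2 ≟ suc (2 * i) / 2) (trans (double/2 i) (sym (suc-double/2 i))))))

windmill-blade-edge : ∀ x y → windmillEdge (5 + x) (5 + y) ≡ true → x < y × x / 2 ≡ y / 2
windmill-blade-edge x y xy∈W =
  does-true (x <? y) (∧-conicalˡ _ _ xy) , does-true (x / 2 ≟ y / 2) (∧-conicalʳ _ _ xy)
  where
  xy = trans (sym (windmillEdge-blades x y)) xy∈W

windmill-nbrs : ∀ x {d} → windmillAdjℕ (5 + x) d ≡ true → d ≡ 0 ⊎ ∃[ y ] (d ≡ 5 + y × y / 2 ≡ x / 2 × y ≢ x)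
windmill-nbrs x {0} _ = inj₁ refl
windmill-nbrs x {1} ()
windmill-nbrs x {2} ()
windmill-nbrs x {3} ()
windmill-nbrs x {4} ()
windmill-nbrs x {suc (suc (suc (suc (suc y))))} xy∈W with ∨-true xy∈W
... | inj₁ xy = let (x<y , half) = windmill-blade-edge x y xy in inj₂ (y , refl , sym half , >⇒≢ x<y)
... | inj₂ yx = let (y<x , half) = windmill-blade-edge y x yx in inj₂ (y , refl , half , <⇒≢ y<x)

windmill-core-isolated : ∀ {p} y → p < 4 → windmillAdjℕ (suc p) (5 + y) ≡ false
windmill-core-isolated {0} _ _ = refl
windmill-core-isolated {1} _ _ = refl
windmill-core-isolated {2} _ _ = refl
windmill-core-isolated {3} _ _ = refl
windmill-core-isolated {suc (suc (suc (suc _)))} _ (s<s (s<s (s<s (s<s ()))))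

houseRel : Subset 6 → ℕ → ℕ → Bool
houseRel (e₁ ∷ e₂ ∷ e₃ ∷ e₄ ∷ e₅ ∷ e₆ ∷ []) = rel
  where
  rel : ℕ → ℕ → Bool
  rel 1 2 = e₁
  rel 2 1 = e₁
  rel 2 3 = e₂
  rel 3 2 = e₂
  rel 3 4 = e₃
  rel 4 3 = e₃
  rel 4 1 = e₄
  rel 1 4 = e₄
  rel 3 0 = e₅
  rel 0 3 = e₅
  rel 4 0 = e₆
  rel 0 4 = e₆
  rel _ _ = false

houseTrace : (ℕ → ℕ → Bool) → Subset 6
houseTrace R = R 1 2 ∷ R 2 3 ∷ R 3 4 ∷ R 4 1 ∷ R 3 0 ∷ R 4 0 ∷ []

CycleDominating : (ℕ → ℕ → Bool) → Set
CycleDominating R = ∀ {a} → a < 5 → ∀ {b} → b < 5 →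
  1 ≤ a × 1 ≤ b × windmillAdjℕ a b ≡ true → ∃[ d ] (d < 5 × (R a d ∨ R b d) ≡ true)

OtherEdge : (ℕ → ℕ → Bool) → ℕ → ℕ → ℕ → ℕ → Set
OtherEdge R a b c e = R c e ≡ true × ¬ SameEdge c e a b

RedundantInHouse : (ℕ → ℕ → Bool) → ℕ → ℕ → Set
RedundantInHouse R a b = ∀ {c} → c < 5 → ∀ {d} → d < 5 → windmillAdjℕ c d ≡ true × Touches c d a b →
  ∃[ e ] (e < 5 × (OtherEdge R a b c e ⊎ OtherEdge R a b d e))

HouseIrredundant : (ℕ → ℕ → Bool) → Set
HouseIrredundant R = ∀ {a} → a < 5 → ∀ {b} → b < 5 → R a b ≡ true → ¬ RedundantInHouse R a b

houseSum : (ℕ → ℕ → Bool) → ℕ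
houseSum R = ∑< 5 λ a → ∑< 5 λ b → 𝟙 (R a b)

HouseProperty : Subset 6 → Set
HouseProperty X = CycleDominating (houseRel X) → HouseIrredundant (houseRel X) → houseSum (houseRel X) ≡ 4

houseProperty? : ∀ X → Dec (HouseProperty X)
houseProperty? X = cycleDominating? →-dec houseIrredundant? →-dec houseSum R ≟ 4
  where
  R = houseRel X
  W = windmillAdjℕ
  otherEdge? : ∀ a b c e → Dec (OtherEdge R a b c e)
  otherEdge? a b c e = R c e Bool.≟ true ×-dec ¬? (sameEdge-dec _≟_ c e a b)
  cycleDominating? = allUpTo? (λ a → allUpTo? (λ b →
    (1 ≤? a ×-dec 1 ≤? b ×-dec W a b Bool.≟ true) →-dec anyUpTo? (λ d → (R a d ∨ R b d) Bool.≟ true) 5) 5) 5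
  houseIrredundant? = allUpTo? (λ a → allUpTo? (λ b → R a b Bool.≟ true →-dec ¬?
    (allUpTo? (λ c → allUpTo? (λ d → (W c d Bool.≟ true ×-dec touches-dec _≟_ c d a b) →-dec
      anyUpTo? (λ e → otherEdge? a b c e ⊎-dec otherEdge? a b d e) 5) 5) 5)) 5) 5

-- The `_` is a proof of `False (anySubset? …)`, found by evaluating the decision on all 64 subsets.
house-check : ∀ X → HouseProperty X
house-check X = decidable-stable (houseProperty? X)
  λ ¬P → toWitnessFalse {a? = anySubset? (¬? ∘ houseProperty?)} _ (X , ¬P)

module Windmill {k} (M : MinimalEDSᴺ (5 + 2 * k) windmillAdjℕ) where

  open MinimalEDSᴺ M
  open Blades {c = 4} {k} M windmill-sym (twins-pendant windmill-twins windmill-nbrs) windmill-core-isolated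

  private
    m = 5 + 2 * k
    R = houseRel (houseTrace F)

  house<m : ∀ {a} → a < 5 → a < m
  house<m a<5 = ≤-trans a<5 (m≤m+n 5 (2 * k))

  F≡R : ∀ {a b} → a < 5 → b < 5 → F a b ≡ R a b
  F≡R {0} {0} _ _ = F-nonedge refl
  F≡R {0} {1} _ _ = F-nonedge refl
  F≡R {0} {2} _ _ = F-nonedge refl
  F≡R {0} {3} _ _ = F-sym 0 3
  F≡R {0} {4} _ _ = F-sym 0 4
  F≡R {1} {0} _ _ = F-nonedge refl
  F≡R {1} {1} _ _ = F-nonedge refl
  F≡R {1} {2} _ _ = refl
  F≡R {1} {3} _ _ = F-nonedge refl
  F≡R {1} {4} _ _ = F-sym 1 4
  F≡R {2} {0} _ _ = F-nonedge refl
  F≡R {2} {1} _ _ = F-sym 2 1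
  F≡R {2} {2} _ _ = F-nonedge refl
  F≡R {2} {3} _ _ = refl
  F≡R {2} {4} _ _ = F-nonedge refl
  F≡R {3} {0} _ _ = refl
  F≡R {3} {1} _ _ = F-nonedge refl
  F≡R {3} {2} _ _ = F-sym 3 2
  F≡R {3} {3} _ _ = F-nonedge refl
  F≡R {3} {4} _ _ = refl
  F≡R {4} {0} _ _ = refl
  F≡R {4} {1} _ _ = refl
  F≡R {4} {2} _ _ = F-nonedge refl
  F≡R {4} {3} _ _ = F-sym 4 3
  F≡R {4} {4} _ _ = F-nonedge refl
  F≡R {suc (suc (suc (suc (suc _))))} (s<s (s<s (s<s (s<s (s<s ()))))) _
  F≡R {_} {suc (suc (suc (suc (suc _))))} _ (s<s (s<s (s<s (s<s (s<s ())))))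

  house-edge : ∀ {p d} → p < 4 → F (suc p) d ≡ true → d < 5 × R (suc p) d ≡ true
  house-edge p<4 pd∈F = d<5 , trans (sym (F≡R (s<s p<4) d<5)) pd∈F
    where
    d<5 = core-neighbour p<4 (F⊆A pd∈F)

  cycle-dominating : CycleDominating R
  cycle-dominating {zero}  _ _ (() , _)
  cycle-dominating {suc a} _ {zero} _ (_ , () , _)
  cycle-dominating {suc a} (s<s a<4) {suc b} (s<s b<4) (_ , _ , ab∈W)
    with dominating (house<m (s<s a<4)) (house<m (s<s b<4)) ab∈W
  ... | _ , d , ad∈F , inj₁ refl = let (d<5 , ad∈R) = house-edge a<4 ad∈F in
                                   d , d<5 , cong (_∨ R (suc b) d) ad∈R
  ... | _ , d , bd∈F , inj₂ refl = let (d<5 , bd∈R) = house-edge b<4 bd∈F in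
                                   d , d<5 , trans (cong (R (suc a) d ∨_) bd∈R) (∨-zeroʳ _)

  house-irredundant : HouseIrredundant R
  house-irredundant {a} a<5 {b} b<5 ab∈R redundant = irredundant (trans (F≡R a<5 b<5) ab∈R) covered
    where
    in-house : ∀ {c d} → c < 5 → d < 5 → ∃[ e ] (e < 5 × (OtherEdge R a b c e ⊎ OtherEdge R a b d e)) →
               DominatedBesides F a b c d
    in-house c<5 _   (e , e<5 , inj₁ (ce∈R , ≠ab)) = _ , e , trans (F≡R c<5 e<5) ce∈R , ≠ab , inj₁ refl
    in-house _   d<5 (e , e<5 , inj₂ (de∈R , ≠ab)) = _ , e , trans (F≡R d<5 e<5) de∈R , ≠ab , inj₂ refl

    spoke : ∀ {c y} → c < 5 → windmillAdjℕ c (5 + y) ≡ true → 5 + y < m → DominatedBesides F a b c (5 + y)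
    spoke c<5 cd∈W d<m with hub-only c<5 cd∈W
    ... | refl = spoke-dominated d<m a<5 b<5

    covered : ∀ {c d} → c < m → d < m → windmillAdjℕ c d ≡ true → Touches c d a b → DominatedBesides F a b c d
    covered {c} {d} c<m d<m cd∈W touch with below-or-beyond 5 c | below-or-beyond 5 d
    ... | inj₁ c<5       | inj₁ d<5       = in-house c<5 d<5 (redundant c<5 d<5 (cd∈W , touch))
    ... | inj₁ c<5       | inj₂ (_ , refl) = spoke c<5 cd∈W d<m
    ... | inj₂ (_ , refl) | inj₁ d<5       = DominatedBesides-swap (spoke d<5 (trans (windmill-sym d c) cd∈W) c<m)
    ... | inj₂ (_ , refl) | inj₂ (_ , refl) =
      ⊥-elim ([ beyond-≢ a<5 , [ beyond-≢ b<5 , [ beyond-≢ a<5 , beyond-≢ b<5 ] ] ] touch)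

  windmill-degreeSum : degreeSumᴺ ≡ 4 + k * 2
  windmill-degreeSum = trans degreeSum-blades (cong (_+ k * 2) (trans house-rows house-sum))
    where
    house-rows : coreSum ≡ houseSum R
    house-rows = ∑<-cong 5 λ a<5 → ∑<-cong 5 λ b<5 → cong 𝟙 (F≡R a<5 b<5)
    house-sum : houseSum R ≡ 4
    house-sum = house-check (houseTrace F) cycle-dominating house-irredundant

lemma2p1 : (G : Graph) → IsPropeller G ⊎ IsWindmill G → WellEdgeDominated G
lemma2p1 G (inj₁ (k , _ , ι , ι-adj)) =
  Labelling.wellEdgeDominated-if-degreeSum-constant ι ι-adj (k * 2) (propeller-degreeSum k)
lemma2p1 G (inj₂ (k , ι , ι-adj)) =
  Labelling.wellEdgeDominated-if-degreeSum-constant ι ι-adj (4 + k * 2) (λ M → Windmill.windmill-degreeSum {k} M)
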